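{- There exists an unsatisfiable $(4,5)$-formula with $235$ clauses.
   Context: A literal is a propositional variable $x$ or its negation $\overline{x}$; a clause is a finite set of literals not containing both a literal and its negation; a CNF formula is a finite set of clauses. A $(k,s)$-formula is a CNF formula in which every clause contains exactly $k$ distinct literals and every variable occurs (positively or negatively) in at most $s$ clauses. -}

module Defs where

open import Data.Nat using (ℕ; _≤_)
open import Data.Bool using (Bool; true; false; not; _≟_)
open import Data.Product using (_×_; _,_; proj₁; proj₂; ∃)
open import Data.List using (List; length; filter)
open import Data.List.Relation.Unary.All using (All)
open import Data.List.Relation.Unary.Any using (Any)
open import Data.List.Relation.Unary.Unique.Propositional using (Unique)
open import Data.List.Relation.Unary.AllPairs using (AllPairs)
open import Data.List.Membership.Propositional using (_∈_)
open import Data.List.Relation.Binary.Subset.Propositional using (_⊆_)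
open import Relation.Binary.PropositionalEquality using (_≡_)
open import Relation.Nullary using (¬_)
open import Relation.Unary using (Decidable)
open import Data.Sum using (_⊎_)
open import Relation.Nullary.Decidable using (_⊎-dec_)
open import Data.Product.Properties using (≡-dec)
import Data.Nat.Properties as ℕP
open import Relation.Binary using (DecidableEquality)

decLit : DecidableEquality (Bool × ℕ)
decLit = ≡-dec _≟_ ℕP._≟_

open import Data.List.Membership.DecPropositional decLit using (_∈?_)

Var : Set
Var = ℕ

-- A literal is a pair (polarity , variable): (true , x) is x, (false , x) is x̄.
Literal : Set
Literal = Bool × Var

var : Literal → Var
var = proj₂

negLit : Literal → Literal
negLit (b , x) = (not b , x)

-- A clause is represented by a duplicate-free list of literals
-- (a finite set), and must not contain a literal together with its negation.
Clause : Set
Clause = List Literal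

IsClause : Clause → Set
IsClause C = Unique C × (∀ l → l ∈ C → ¬ (negLit l ∈ C))

-- A CNF formula is a finite set of clauses: a list of clauses, no two of
-- which denote the same set of literals.
Formula : Set
Formula = List Clause

SameSet : Clause → Clause → Set
SameSet C D = (C ⊆ D) × (D ⊆ C)

IsCNF : Formula → Set
IsCNF F = All IsClause F × AllPairs (λ C D → ¬ SameSet C D) F

Occurs : Var → Clause → Set
Occurs x C = ((true , x) ∈ C) ⊎ ((false , x) ∈ C)

occurs? : (x : Var) → Decidable (Occurs x)
occurs? x C = ((true , x) ∈? C) ⊎-dec ((false , x) ∈? C)

occurrences : Var → Formula → ℕ
occurrences x F = length (filter (occurs? x) F)

IsKSFormula : ℕ → ℕ → Formula → Set
IsKSFormula k s F =
  IsCNF F × All (λ C → length C ≡ k) F × (∀ x → occurrences x F ≤ s)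

Assignment : Set
Assignment = Var → Bool

litTrue : Assignment → Literal → Set
litTrue α (b , x) = α x ≡ b

Satisfies : Assignment → Formula → Set
Satisfies α F = All (λ C → Any (litTrue α) C) F

Unsatisfiable : Formula → Set
Unsatisfiable F = ∀ (α : Assignment) → ¬ Satisfies α F

-- Unsatisfiability is certified by a decision tree on the variables whose leaves name a
-- clause falsified along their branch: every assignment follows one branch to the end,
-- so it falsifies the clause named there.
module Submission where

open import Defs
open import Data.Bool using (true; false)
open import Data.Bool.Properties using (not-¬)
open import Data.Nat using (ℕ; zero; suc; _≤_; _<_; _≤?_; _<?_; z≤n)
open import Data.Nat.Properties using (<⇒≱; ≮⇒≥)
import Data.Nat.Properties as ℕ
open import Data.Product using (∃; _×_; _,_)
open import Data.Sum using (inj₁; inj₂)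
open import Data.List using (List; []; _∷_; length; drop; upTo)
open import Data.List.Properties using (filter-none)
open import Data.List.Relation.Unary.All as All using (All; []; _∷_; all?)
open import Data.List.Relation.Unary.All.Properties using (All¬⇒¬Any)
open import Data.List.Relation.Unary.Any using (Any; there; any?)
open import Data.List.Relation.Unary.AllPairs using (allPairs?)
open import Data.List.Relation.Unary.Unique.DecPropositional decLit using (unique?)
open import Data.List.Membership.Propositional using (_∈_)
open import Data.List.Membership.Propositional.Properties using (∈-upTo⁺)
open import Data.List.Membership.DecPropositional decLit using (_∈?_)
open import Data.List.Relation.Binary.Subset.DecPropositional decLit using (_⊆?_)
open import Relation.Binary.PropositionalEquality using (_≡_; refl; cong)
open import Relation.Nullary using (¬_; Dec; yes; no)
open import Relation.Nullary.Decidable using (from-yes; map′; ¬?; _×-dec_)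
open import Relation.Unary using (Pred; Decidable)

isClause? : Decidable IsClause
isClause? C = unique? C ×-dec map′ (λ h l → All.lookup h) (λ h → All.tabulate (h _)) noComplements?
  where
  noComplements? : Dec (All (λ l → ¬ negLit l ∈ C) C)
  noComplements? = all? (λ l → ¬? (negLit l ∈? C)) C

isCNF? : Decidable IsCNF
isCNF? F = all? isClause? F ×-dec allPairs? (λ C D → ¬? (C ⊆? D ×-dec D ⊆? C)) F

VarsBelow : ℕ → Formula → Set
VarsBelow n F = All (All (λ l → var l < n)) F

varsBelow? : ∀ n → Decidable (VarsBelow n)
varsBelow? n = all? (all? (λ l → var l <? n))

occurrences-≡0 : ∀ {n F x} → VarsBelow n F → n ≤ x → occurrences x F ≡ 0
occurrences-≡0 {n} {x = x} below n≤x =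
  cong length (filter-none (occurs? x) (All.map absent below))
  where
  absent : ∀ {C} → All (λ l → var l < n) C → ¬ Occurs x C
  absent vs (inj₁ x∈C) = <⇒≱ (All.lookup vs x∈C) n≤x
  absent vs (inj₂ x̄∈C) = <⇒≱ (All.lookup vs x̄∈C) n≤x

occurrences-≤ : ∀ {n s F} → VarsBelow n F →
                All (λ x → occurrences x F ≤ s) (upTo n) → ∀ x → occurrences x F ≤ s
occurrences-≤ {n} below bounded x with x <? n
... | yes x<n = All.lookup bounded (∈-upTo⁺ x<n)
... | no  x≮n rewrite occurrences-≡0 below (≮⇒≥ x≮n) = z≤n

PartialAssignment : Set
PartialAssignment = List Literal

pos neg : Var → Literal
pos x = true , x
neg x = false , x

Falsifies : PartialAssignment → Clause → Set
Falsifies ρ C = All (λ l → negLit l ∈ ρ) C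

falsifies? : ∀ ρ → Decidable (Falsifies ρ)
falsifies? ρ = all? (λ l → negLit l ∈? ρ)

falsified⇒¬satisfied : ∀ {α ρ C} → All (litTrue α) ρ → Falsifies ρ C → ¬ Any (litTrue α) C
falsified⇒¬satisfied {α} αρ ρ⊭C = All¬⇒¬Any (All.map opposite ρ⊭C)
  where
  opposite : ∀ {l} → negLit l ∈ _ → ¬ litTrue α l
  opposite m αl = not-¬ αl (All.lookup αρ m)

Any-drop⁻ : ∀ {a p} {A : Set a} {P : Pred A p} i {xs : List A} → Any P (drop i xs) → Any P xs
Any-drop⁻ zero    p = p
Any-drop⁻ (suc i) {_ ∷ _} p = there (Any-drop⁻ i p)

data Refutation : Set where
  conflict : ℕ → Refutation
  split    : Var → Refutation → Refutation → Refutation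

-- The index of a conflict is only a hint: the clause is searched for from that position on.
Refutes : Formula → PartialAssignment → Refutation → Set
Refutes F ρ (conflict i)    = Any (Falsifies ρ) (drop i F)
Refutes F ρ (split x r₀ r₁) = Refutes F (neg x ∷ ρ) r₀ × Refutes F (pos x ∷ ρ) r₁

refutes? : ∀ F ρ r → Dec (Refutes F ρ r)
refutes? F ρ (conflict i)    = any? (falsifies? ρ) (drop i F)
refutes? F ρ (split x r₀ r₁) = refutes? F (neg x ∷ ρ) r₀ ×-dec refutes? F (pos x ∷ ρ) r₁

refutes-sound : ∀ {F ρ α} r → Refutes F ρ r → All (litTrue α) ρ → ¬ Satisfies α F
refutes-sound (conflict i) ρ⊭F αρ sat
  with αC , ρ⊭C ← All.lookupAny sat (Any-drop⁻ i ρ⊭F) = falsified⇒¬satisfied αρ ρ⊭C αC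
refutes-sound {α = α} (split x r₀ r₁) (ref₀ , ref₁) αρ sat with α x in αx
... | false = refutes-sound r₀ ref₀ (αx ∷ αρ) sat
... | true  = refutes-sound r₁ ref₁ (αx ∷ αρ) sat

refuted⇒unsatisfiable : ∀ {F} r → Refutes F [] r → Unsatisfiable F
refuted⇒unsatisfiable r ref α = refutes-sound r ref []

formula : Formula
formula =
  (neg 0 ∷ pos 1 ∷ neg 2 ∷ pos 3 ∷ []) ∷
  (neg 0 ∷ pos 1 ∷ neg 2 ∷ neg 3 ∷ []) ∷
  (pos 0 ∷ neg 1 ∷ pos 2 ∷ pos 4 ∷ []) ∷
  (pos 0 ∷ pos 1 ∷ pos 4 ∷ pos 5 ∷ []) ∷
  (neg 0 ∷ pos 2 ∷ pos 4 ∷ pos 5 ∷ []) ∷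
  (neg 1 ∷ neg 2 ∷ pos 4 ∷ pos 5 ∷ []) ∷
  (neg 6 ∷ neg 7 ∷ neg 8 ∷ pos 9 ∷ []) ∷
  (neg 6 ∷ neg 7 ∷ neg 8 ∷ neg 9 ∷ []) ∷
  (neg 6 ∷ neg 7 ∷ pos 8 ∷ neg 10 ∷ []) ∷
  (neg 4 ∷ pos 5 ∷ pos 10 ∷ pos 11 ∷ []) ∷
  (neg 6 ∷ pos 7 ∷ neg 10 ∷ pos 11 ∷ []) ∷
  (neg 12 ∷ pos 13 ∷ neg 14 ∷ pos 15 ∷ []) ∷
  (neg 12 ∷ pos 13 ∷ neg 14 ∷ neg 15 ∷ []) ∷
  (pos 12 ∷ neg 13 ∷ pos 14 ∷ pos 16 ∷ []) ∷
  (pos 12 ∷ pos 13 ∷ pos 16 ∷ pos 17 ∷ []) ∷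
  (neg 12 ∷ pos 14 ∷ pos 16 ∷ pos 17 ∷ []) ∷
  (neg 13 ∷ neg 14 ∷ pos 16 ∷ pos 17 ∷ []) ∷
  (neg 5 ∷ pos 10 ∷ pos 11 ∷ pos 18 ∷ []) ∷
  (pos 6 ∷ neg 10 ∷ pos 11 ∷ pos 18 ∷ []) ∷
  (neg 19 ∷ pos 20 ∷ neg 21 ∷ pos 22 ∷ []) ∷
  (neg 19 ∷ pos 20 ∷ neg 21 ∷ neg 22 ∷ []) ∷
  (pos 19 ∷ neg 20 ∷ pos 21 ∷ pos 23 ∷ []) ∷
  (pos 19 ∷ pos 20 ∷ pos 23 ∷ pos 24 ∷ []) ∷
  (neg 19 ∷ pos 21 ∷ pos 23 ∷ pos 24 ∷ []) ∷
  (neg 20 ∷ neg 21 ∷ pos 23 ∷ pos 24 ∷ []) ∷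
  (neg 16 ∷ pos 17 ∷ neg 18 ∷ pos 25 ∷ []) ∷
  (neg 11 ∷ pos 18 ∷ pos 25 ∷ pos 26 ∷ []) ∷
  (neg 17 ∷ neg 18 ∷ pos 25 ∷ pos 26 ∷ []) ∷
  (neg 23 ∷ pos 24 ∷ neg 25 ∷ pos 26 ∷ []) ∷
  (neg 27 ∷ pos 28 ∷ neg 29 ∷ pos 30 ∷ []) ∷
  (neg 27 ∷ pos 28 ∷ neg 29 ∷ neg 30 ∷ []) ∷
  (pos 27 ∷ neg 28 ∷ pos 29 ∷ pos 31 ∷ []) ∷
  (pos 27 ∷ pos 28 ∷ pos 31 ∷ pos 32 ∷ []) ∷
  (neg 27 ∷ pos 29 ∷ pos 31 ∷ pos 32 ∷ []) ∷
  (neg 28 ∷ neg 29 ∷ pos 31 ∷ pos 32 ∷ []) ∷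
  (neg 33 ∷ neg 34 ∷ neg 35 ∷ pos 36 ∷ []) ∷
  (neg 33 ∷ neg 34 ∷ neg 35 ∷ neg 36 ∷ []) ∷
  (neg 33 ∷ neg 34 ∷ pos 35 ∷ neg 37 ∷ []) ∷
  (neg 31 ∷ pos 32 ∷ pos 37 ∷ pos 38 ∷ []) ∷
  (neg 33 ∷ pos 34 ∷ neg 37 ∷ pos 38 ∷ []) ∷
  (neg 39 ∷ pos 40 ∷ neg 41 ∷ pos 42 ∷ []) ∷
  (neg 39 ∷ pos 40 ∷ neg 41 ∷ neg 42 ∷ []) ∷
  (pos 39 ∷ neg 40 ∷ pos 41 ∷ pos 43 ∷ []) ∷
  (pos 39 ∷ pos 40 ∷ pos 43 ∷ pos 44 ∷ []) ∷
  (neg 39 ∷ pos 41 ∷ pos 43 ∷ pos 44 ∷ []) ∷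
  (neg 40 ∷ neg 41 ∷ pos 43 ∷ pos 44 ∷ []) ∷
  (neg 32 ∷ pos 37 ∷ pos 38 ∷ pos 45 ∷ []) ∷
  (pos 33 ∷ neg 37 ∷ pos 38 ∷ pos 45 ∷ []) ∷
  (neg 24 ∷ neg 25 ∷ pos 26 ∷ pos 46 ∷ []) ∷
  (neg 43 ∷ pos 44 ∷ neg 45 ∷ neg 46 ∷ []) ∷
  (neg 47 ∷ pos 48 ∷ neg 49 ∷ pos 50 ∷ []) ∷
  (neg 47 ∷ pos 48 ∷ neg 49 ∷ neg 50 ∷ []) ∷
  (pos 47 ∷ neg 48 ∷ pos 49 ∷ pos 51 ∷ []) ∷
  (pos 47 ∷ pos 48 ∷ pos 51 ∷ pos 52 ∷ []) ∷
  (neg 47 ∷ pos 49 ∷ pos 51 ∷ pos 52 ∷ []) ∷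
  (neg 48 ∷ neg 49 ∷ pos 51 ∷ pos 52 ∷ []) ∷
  (neg 53 ∷ neg 54 ∷ neg 55 ∷ pos 56 ∷ []) ∷
  (neg 53 ∷ neg 54 ∷ neg 55 ∷ neg 56 ∷ []) ∷
  (neg 53 ∷ neg 54 ∷ pos 55 ∷ neg 57 ∷ []) ∷
  (neg 51 ∷ pos 52 ∷ pos 57 ∷ pos 58 ∷ []) ∷
  (neg 53 ∷ pos 54 ∷ neg 57 ∷ pos 58 ∷ []) ∷
  (neg 59 ∷ pos 60 ∷ neg 61 ∷ pos 62 ∷ []) ∷
  (neg 59 ∷ pos 60 ∷ neg 61 ∷ neg 62 ∷ []) ∷
  (pos 59 ∷ neg 60 ∷ pos 61 ∷ pos 63 ∷ []) ∷
  (pos 59 ∷ pos 60 ∷ pos 63 ∷ pos 64 ∷ []) ∷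
  (neg 59 ∷ pos 61 ∷ pos 63 ∷ pos 64 ∷ []) ∷
  (neg 60 ∷ neg 61 ∷ pos 63 ∷ pos 64 ∷ []) ∷
  (neg 52 ∷ pos 57 ∷ pos 58 ∷ pos 65 ∷ []) ∷
  (pos 53 ∷ neg 57 ∷ pos 58 ∷ pos 65 ∷ []) ∷
  (neg 66 ∷ pos 67 ∷ neg 68 ∷ pos 69 ∷ []) ∷
  (neg 66 ∷ pos 67 ∷ neg 68 ∷ neg 69 ∷ []) ∷
  (pos 66 ∷ neg 67 ∷ pos 68 ∷ pos 70 ∷ []) ∷
  (pos 66 ∷ pos 67 ∷ pos 70 ∷ pos 71 ∷ []) ∷
  (neg 66 ∷ pos 68 ∷ pos 70 ∷ pos 71 ∷ []) ∷
  (neg 67 ∷ neg 68 ∷ pos 70 ∷ pos 71 ∷ []) ∷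
  (neg 63 ∷ pos 64 ∷ neg 65 ∷ pos 72 ∷ []) ∷
  (neg 58 ∷ pos 65 ∷ pos 72 ∷ pos 73 ∷ []) ∷
  (neg 64 ∷ neg 65 ∷ pos 72 ∷ pos 73 ∷ []) ∷
  (neg 70 ∷ pos 71 ∷ neg 72 ∷ pos 73 ∷ []) ∷
  (neg 38 ∷ pos 45 ∷ neg 46 ∷ pos 74 ∷ []) ∷
  (neg 44 ∷ neg 45 ∷ neg 46 ∷ pos 74 ∷ []) ∷
  (neg 71 ∷ neg 72 ∷ pos 73 ∷ neg 74 ∷ []) ∷
  (neg 75 ∷ pos 76 ∷ neg 77 ∷ pos 78 ∷ []) ∷
  (neg 75 ∷ pos 76 ∷ neg 77 ∷ neg 78 ∷ []) ∷
  (pos 75 ∷ neg 76 ∷ pos 77 ∷ pos 79 ∷ []) ∷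
  (pos 75 ∷ pos 76 ∷ pos 79 ∷ pos 80 ∷ []) ∷
  (neg 75 ∷ pos 77 ∷ pos 79 ∷ pos 80 ∷ []) ∷
  (neg 76 ∷ neg 77 ∷ pos 79 ∷ pos 80 ∷ []) ∷
  (neg 81 ∷ neg 82 ∷ neg 83 ∷ pos 84 ∷ []) ∷
  (neg 81 ∷ neg 82 ∷ neg 83 ∷ neg 84 ∷ []) ∷
  (neg 81 ∷ neg 82 ∷ pos 83 ∷ neg 85 ∷ []) ∷
  (neg 79 ∷ pos 80 ∷ pos 85 ∷ pos 86 ∷ []) ∷
  (neg 81 ∷ pos 82 ∷ neg 85 ∷ pos 86 ∷ []) ∷
  (neg 87 ∷ pos 88 ∷ neg 89 ∷ pos 90 ∷ []) ∷
  (neg 87 ∷ pos 88 ∷ neg 89 ∷ neg 90 ∷ []) ∷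
  (pos 87 ∷ neg 88 ∷ pos 89 ∷ pos 91 ∷ []) ∷
  (pos 87 ∷ pos 88 ∷ pos 91 ∷ pos 92 ∷ []) ∷
  (neg 87 ∷ pos 89 ∷ pos 91 ∷ pos 92 ∷ []) ∷
  (neg 88 ∷ neg 89 ∷ pos 91 ∷ pos 92 ∷ []) ∷
  (neg 80 ∷ pos 85 ∷ pos 86 ∷ pos 93 ∷ []) ∷
  (pos 81 ∷ neg 85 ∷ pos 86 ∷ pos 93 ∷ []) ∷
  (neg 94 ∷ pos 95 ∷ neg 96 ∷ pos 97 ∷ []) ∷
  (neg 94 ∷ pos 95 ∷ neg 96 ∷ neg 97 ∷ []) ∷
  (pos 94 ∷ neg 95 ∷ pos 96 ∷ pos 98 ∷ []) ∷
  (pos 94 ∷ pos 95 ∷ pos 98 ∷ pos 99 ∷ []) ∷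
  (neg 94 ∷ pos 96 ∷ pos 98 ∷ pos 99 ∷ []) ∷
  (neg 95 ∷ neg 96 ∷ pos 98 ∷ pos 99 ∷ []) ∷
  (neg 91 ∷ pos 92 ∷ neg 93 ∷ pos 100 ∷ []) ∷
  (neg 86 ∷ pos 93 ∷ pos 100 ∷ pos 101 ∷ []) ∷
  (neg 92 ∷ neg 93 ∷ pos 100 ∷ pos 101 ∷ []) ∷
  (neg 98 ∷ pos 99 ∷ neg 100 ∷ pos 101 ∷ []) ∷
  (neg 102 ∷ pos 103 ∷ neg 104 ∷ pos 105 ∷ []) ∷
  (neg 102 ∷ pos 103 ∷ neg 104 ∷ neg 105 ∷ []) ∷
  (pos 102 ∷ neg 103 ∷ pos 104 ∷ pos 106 ∷ []) ∷
  (pos 102 ∷ pos 103 ∷ pos 106 ∷ pos 107 ∷ []) ∷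
  (neg 102 ∷ pos 104 ∷ pos 106 ∷ pos 107 ∷ []) ∷
  (neg 103 ∷ neg 104 ∷ pos 106 ∷ pos 107 ∷ []) ∷
  (neg 108 ∷ neg 109 ∷ neg 110 ∷ pos 111 ∷ []) ∷
  (neg 108 ∷ neg 109 ∷ neg 110 ∷ neg 111 ∷ []) ∷
  (neg 108 ∷ neg 109 ∷ pos 110 ∷ neg 112 ∷ []) ∷
  (neg 106 ∷ pos 107 ∷ pos 112 ∷ pos 113 ∷ []) ∷
  (neg 108 ∷ pos 109 ∷ neg 112 ∷ pos 113 ∷ []) ∷
  (neg 114 ∷ pos 115 ∷ neg 116 ∷ pos 117 ∷ []) ∷
  (neg 114 ∷ pos 115 ∷ neg 116 ∷ neg 117 ∷ []) ∷
  (pos 114 ∷ neg 115 ∷ pos 116 ∷ pos 118 ∷ []) ∷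
  (pos 114 ∷ pos 115 ∷ pos 118 ∷ pos 119 ∷ []) ∷
  (neg 114 ∷ pos 116 ∷ pos 118 ∷ pos 119 ∷ []) ∷
  (neg 115 ∷ neg 116 ∷ pos 118 ∷ pos 119 ∷ []) ∷
  (neg 107 ∷ pos 112 ∷ pos 113 ∷ pos 120 ∷ []) ∷
  (pos 108 ∷ neg 112 ∷ pos 113 ∷ pos 120 ∷ []) ∷
  (neg 99 ∷ neg 100 ∷ pos 101 ∷ pos 121 ∷ []) ∷
  (neg 118 ∷ pos 119 ∷ neg 120 ∷ neg 121 ∷ []) ∷
  (neg 26 ∷ pos 46 ∷ pos 74 ∷ pos 122 ∷ []) ∷
  (neg 113 ∷ pos 120 ∷ neg 121 ∷ neg 122 ∷ []) ∷
  (neg 119 ∷ neg 120 ∷ neg 121 ∷ neg 122 ∷ []) ∷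
  (neg 123 ∷ pos 124 ∷ neg 125 ∷ pos 126 ∷ []) ∷
  (neg 123 ∷ pos 124 ∷ neg 125 ∷ neg 126 ∷ []) ∷
  (pos 123 ∷ neg 124 ∷ pos 125 ∷ pos 127 ∷ []) ∷
  (pos 123 ∷ pos 124 ∷ pos 127 ∷ pos 128 ∷ []) ∷
  (neg 123 ∷ pos 125 ∷ pos 127 ∷ pos 128 ∷ []) ∷
  (neg 124 ∷ neg 125 ∷ pos 127 ∷ pos 128 ∷ []) ∷
  (neg 129 ∷ neg 130 ∷ neg 131 ∷ pos 132 ∷ []) ∷
  (neg 129 ∷ neg 130 ∷ neg 131 ∷ neg 132 ∷ []) ∷
  (neg 129 ∷ neg 130 ∷ pos 131 ∷ neg 133 ∷ []) ∷
  (neg 127 ∷ pos 128 ∷ pos 133 ∷ pos 134 ∷ []) ∷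
  (neg 129 ∷ pos 130 ∷ neg 133 ∷ pos 134 ∷ []) ∷
  (neg 135 ∷ pos 136 ∷ neg 137 ∷ pos 138 ∷ []) ∷
  (neg 135 ∷ pos 136 ∷ neg 137 ∷ neg 138 ∷ []) ∷
  (pos 135 ∷ neg 136 ∷ pos 137 ∷ pos 139 ∷ []) ∷
  (pos 135 ∷ pos 136 ∷ pos 139 ∷ pos 140 ∷ []) ∷
  (neg 135 ∷ pos 137 ∷ pos 139 ∷ pos 140 ∷ []) ∷
  (neg 136 ∷ neg 137 ∷ pos 139 ∷ pos 140 ∷ []) ∷
  (neg 128 ∷ pos 133 ∷ pos 134 ∷ pos 141 ∷ []) ∷
  (pos 129 ∷ neg 133 ∷ pos 134 ∷ pos 141 ∷ []) ∷
  (neg 142 ∷ pos 143 ∷ neg 144 ∷ pos 145 ∷ []) ∷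
  (neg 142 ∷ pos 143 ∷ neg 144 ∷ neg 145 ∷ []) ∷
  (pos 142 ∷ neg 143 ∷ pos 144 ∷ pos 146 ∷ []) ∷
  (pos 142 ∷ pos 143 ∷ pos 146 ∷ pos 147 ∷ []) ∷
  (neg 142 ∷ pos 144 ∷ pos 146 ∷ pos 147 ∷ []) ∷
  (neg 143 ∷ neg 144 ∷ pos 146 ∷ pos 147 ∷ []) ∷
  (neg 139 ∷ pos 140 ∷ neg 141 ∷ pos 148 ∷ []) ∷
  (neg 134 ∷ pos 141 ∷ pos 148 ∷ pos 149 ∷ []) ∷
  (neg 140 ∷ neg 141 ∷ pos 148 ∷ pos 149 ∷ []) ∷
  (neg 146 ∷ pos 147 ∷ neg 148 ∷ pos 149 ∷ []) ∷
  (neg 150 ∷ pos 151 ∷ neg 152 ∷ pos 153 ∷ []) ∷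
  (neg 150 ∷ pos 151 ∷ neg 152 ∷ neg 153 ∷ []) ∷
  (pos 150 ∷ neg 151 ∷ pos 152 ∷ pos 154 ∷ []) ∷
  (pos 150 ∷ pos 151 ∷ pos 154 ∷ pos 155 ∷ []) ∷
  (neg 150 ∷ pos 152 ∷ pos 154 ∷ pos 155 ∷ []) ∷
  (neg 151 ∷ neg 152 ∷ pos 154 ∷ pos 155 ∷ []) ∷
  (neg 156 ∷ neg 157 ∷ neg 158 ∷ pos 159 ∷ []) ∷
  (neg 156 ∷ neg 157 ∷ neg 158 ∷ neg 159 ∷ []) ∷
  (neg 156 ∷ neg 157 ∷ pos 158 ∷ neg 160 ∷ []) ∷
  (neg 154 ∷ pos 155 ∷ pos 160 ∷ pos 161 ∷ []) ∷
  (neg 156 ∷ pos 157 ∷ neg 160 ∷ pos 161 ∷ []) ∷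
  (neg 162 ∷ pos 163 ∷ neg 164 ∷ pos 165 ∷ []) ∷
  (neg 162 ∷ pos 163 ∷ neg 164 ∷ neg 165 ∷ []) ∷
  (pos 162 ∷ neg 163 ∷ pos 164 ∷ pos 166 ∷ []) ∷
  (pos 162 ∷ pos 163 ∷ pos 166 ∷ pos 167 ∷ []) ∷
  (neg 162 ∷ pos 164 ∷ pos 166 ∷ pos 167 ∷ []) ∷
  (neg 163 ∷ neg 164 ∷ pos 166 ∷ pos 167 ∷ []) ∷
  (neg 155 ∷ pos 160 ∷ pos 161 ∷ pos 168 ∷ []) ∷
  (pos 156 ∷ neg 160 ∷ pos 161 ∷ pos 168 ∷ []) ∷
  (neg 147 ∷ neg 148 ∷ pos 149 ∷ pos 169 ∷ []) ∷
  (neg 166 ∷ pos 167 ∷ neg 168 ∷ neg 169 ∷ []) ∷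
  (neg 170 ∷ pos 171 ∷ neg 172 ∷ pos 173 ∷ []) ∷
  (neg 170 ∷ pos 171 ∷ neg 172 ∷ neg 173 ∷ []) ∷
  (pos 170 ∷ neg 171 ∷ pos 172 ∷ pos 174 ∷ []) ∷
  (pos 170 ∷ pos 171 ∷ pos 174 ∷ pos 175 ∷ []) ∷
  (neg 170 ∷ pos 172 ∷ pos 174 ∷ pos 175 ∷ []) ∷
  (neg 171 ∷ neg 172 ∷ pos 174 ∷ pos 175 ∷ []) ∷
  (neg 176 ∷ neg 177 ∷ neg 178 ∷ pos 179 ∷ []) ∷
  (neg 176 ∷ neg 177 ∷ neg 178 ∷ neg 179 ∷ []) ∷
  (neg 176 ∷ neg 177 ∷ pos 178 ∷ neg 180 ∷ []) ∷
  (neg 174 ∷ pos 175 ∷ pos 180 ∷ pos 181 ∷ []) ∷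
  (neg 176 ∷ pos 177 ∷ neg 180 ∷ pos 181 ∷ []) ∷
  (neg 182 ∷ pos 183 ∷ neg 184 ∷ pos 185 ∷ []) ∷
  (neg 182 ∷ pos 183 ∷ neg 184 ∷ neg 185 ∷ []) ∷
  (pos 182 ∷ neg 183 ∷ pos 184 ∷ pos 186 ∷ []) ∷
  (pos 182 ∷ pos 183 ∷ pos 186 ∷ pos 187 ∷ []) ∷
  (neg 182 ∷ pos 184 ∷ pos 186 ∷ pos 187 ∷ []) ∷
  (neg 183 ∷ neg 184 ∷ pos 186 ∷ pos 187 ∷ []) ∷
  (neg 175 ∷ pos 180 ∷ pos 181 ∷ pos 188 ∷ []) ∷
  (pos 176 ∷ neg 180 ∷ pos 181 ∷ pos 188 ∷ []) ∷
  (neg 189 ∷ pos 190 ∷ neg 191 ∷ pos 192 ∷ []) ∷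
  (neg 189 ∷ pos 190 ∷ neg 191 ∷ neg 192 ∷ []) ∷
  (pos 189 ∷ neg 190 ∷ pos 191 ∷ pos 193 ∷ []) ∷
  (pos 189 ∷ pos 190 ∷ pos 193 ∷ pos 194 ∷ []) ∷
  (neg 189 ∷ pos 191 ∷ pos 193 ∷ pos 194 ∷ []) ∷
  (neg 190 ∷ neg 191 ∷ pos 193 ∷ pos 194 ∷ []) ∷
  (neg 186 ∷ pos 187 ∷ neg 188 ∷ pos 195 ∷ []) ∷
  (neg 181 ∷ pos 188 ∷ pos 195 ∷ pos 196 ∷ []) ∷
  (neg 187 ∷ neg 188 ∷ pos 195 ∷ pos 196 ∷ []) ∷
  (neg 193 ∷ pos 194 ∷ neg 195 ∷ pos 196 ∷ []) ∷
  (neg 197 ∷ pos 198 ∷ neg 199 ∷ pos 200 ∷ []) ∷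
  (neg 197 ∷ pos 198 ∷ neg 199 ∷ neg 200 ∷ []) ∷
  (pos 197 ∷ neg 198 ∷ pos 199 ∷ pos 201 ∷ []) ∷
  (pos 197 ∷ pos 198 ∷ pos 201 ∷ pos 202 ∷ []) ∷
  (neg 197 ∷ pos 199 ∷ pos 201 ∷ pos 202 ∷ []) ∷
  (neg 198 ∷ neg 199 ∷ pos 201 ∷ pos 202 ∷ []) ∷
  (neg 203 ∷ neg 204 ∷ neg 205 ∷ pos 206 ∷ []) ∷
  (neg 203 ∷ neg 204 ∷ neg 205 ∷ neg 206 ∷ []) ∷
  (neg 203 ∷ neg 204 ∷ pos 205 ∷ neg 207 ∷ []) ∷
  (neg 201 ∷ pos 202 ∷ pos 207 ∷ pos 208 ∷ []) ∷
  (neg 203 ∷ pos 204 ∷ neg 207 ∷ pos 208 ∷ []) ∷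
  (neg 194 ∷ neg 195 ∷ pos 196 ∷ pos 209 ∷ []) ∷
  (neg 202 ∷ pos 207 ∷ pos 208 ∷ neg 209 ∷ []) ∷
  (pos 203 ∷ neg 207 ∷ pos 208 ∷ neg 209 ∷ []) ∷
  (neg 161 ∷ pos 168 ∷ neg 169 ∷ pos 210 ∷ []) ∷
  (neg 167 ∷ neg 168 ∷ neg 169 ∷ pos 210 ∷ []) ∷
  (neg 73 ∷ neg 74 ∷ pos 122 ∷ pos 211 ∷ []) ∷
  (neg 101 ∷ pos 121 ∷ neg 122 ∷ pos 211 ∷ []) ∷
  (neg 149 ∷ pos 169 ∷ pos 210 ∷ neg 211 ∷ []) ∷
  (neg 196 ∷ pos 209 ∷ neg 210 ∷ neg 211 ∷ []) ∷
  (neg 208 ∷ neg 209 ∷ neg 210 ∷ neg 211 ∷ []) ∷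
  []

refutation : Refutation
refutation =
  split 211 (split 122 (split 74 (split 46 (split 26 (split 25 (split 18 (split 11 (split 10
  (split 5 (split 4 (split 0 (split 1 (split 2 (split 3 (conflict 3) (conflict 3)) (split 3
  (conflict 3) (conflict 3))) (split 2 (split 3 (conflict 2) (conflict 2)) (split 3 (conflict 5)
  (conflict 5)))) (split 1 (split 2 (split 3 (conflict 4) (conflict 4)) (split 3 (conflict 0)
  (conflict 1))) (split 2 (split 3 (conflict 4) (conflict 4)) (split 3 (conflict 5) (conflict
  5))))) (conflict 9)) (conflict 17)) (split 6 (split 7 (split 8 (split 9 (conflict 18) (conflict
  18)) (split 9 (conflict 18) (conflict 18))) (split 8 (split 9 (conflict 18) (conflict 18))
  (split 9 (conflict 18) (conflict 18)))) (split 7 (split 8 (split 9 (conflict 10) (conflict 10))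
  (split 9 (conflict 10) (conflict 10))) (split 8 (split 9 (conflict 8) (conflict 8)) (split 9
  (conflict 6) (conflict 7)))))) (conflict 26)) (split 17 (split 16 (split 12 (split 13 (split 14
  (split 15 (conflict 14) (conflict 14)) (split 15 (conflict 14) (conflict 14))) (split 14 (split
  15 (conflict 13) (conflict 13)) (split 15 (conflict 16) (conflict 16)))) (split 13 (split 14
  (split 15 (conflict 15) (conflict 15)) (split 15 (conflict 11) (conflict 12))) (split 14 (split
  15 (conflict 15) (conflict 15)) (split 15 (conflict 16) (conflict 16))))) (conflict 25))
  (conflict 27))) (split 24 (split 23 (split 19 (split 20 (split 21 (split 22 (conflict 22)
  (conflict 22)) (split 22 (conflict 22) (conflict 22))) (split 21 (split 22 (conflict 21)
  (conflict 21)) (split 22 (conflict 24) (conflict 24)))) (split 20 (split 21 (split 22 (conflict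
  23) (conflict 23)) (split 22 (conflict 19) (conflict 20))) (split 21 (split 22 (conflict 23)
  (conflict 23)) (split 22 (conflict 24) (conflict 24))))) (conflict 28)) (conflict 48)))
  (conflict 132)) (split 45 (split 38 (split 37 (split 32 (split 31 (split 27 (split 28 (split 29
  (split 30 (conflict 32) (conflict 32)) (split 30 (conflict 32) (conflict 32))) (split 29 (split
  30 (conflict 31) (conflict 31)) (split 30 (conflict 34) (conflict 34)))) (split 28 (split 29
  (split 30 (conflict 33) (conflict 33)) (split 30 (conflict 29) (conflict 30))) (split 29 (split
  30 (conflict 33) (conflict 33)) (split 30 (conflict 34) (conflict 34))))) (conflict 38))
  (conflict 46)) (split 33 (split 34 (split 35 (split 36 (conflict 47) (conflict 47)) (split 36
  (conflict 47) (conflict 47))) (split 35 (split 36 (conflict 47) (conflict 47)) (split 36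
  (conflict 47) (conflict 47)))) (split 34 (split 35 (split 36 (conflict 39) (conflict 39)) (split
  36 (conflict 39) (conflict 39))) (split 35 (split 36 (conflict 37) (conflict 37)) (split 36
  (conflict 35) (conflict 36)))))) (conflict 79)) (split 44 (split 43 (split 39 (split 40 (split
  41 (split 42 (conflict 43) (conflict 43)) (split 42 (conflict 43) (conflict 43))) (split 41
  (split 42 (conflict 42) (conflict 42)) (split 42 (conflict 45) (conflict 45)))) (split 40 (split
  41 (split 42 (conflict 44) (conflict 44)) (split 42 (conflict 40) (conflict 41))) (split 41
  (split 42 (conflict 44) (conflict 44)) (split 42 (conflict 45) (conflict 45))))) (conflict 49))
  (conflict 80)))) (split 73 (split 72 (split 65 (split 58 (split 57 (split 52 (split 51 (split 47
  (split 48 (split 49 (split 50 (conflict 53) (conflict 53)) (split 50 (conflict 53) (conflict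
  53))) (split 49 (split 50 (conflict 52) (conflict 52)) (split 50 (conflict 55) (conflict 55))))
  (split 48 (split 49 (split 50 (conflict 54) (conflict 54)) (split 50 (conflict 50) (conflict
  51))) (split 49 (split 50 (conflict 54) (conflict 54)) (split 50 (conflict 55) (conflict 55)))))
  (conflict 59)) (conflict 67)) (split 53 (split 54 (split 55 (split 56 (conflict 68) (conflict
  68)) (split 56 (conflict 68) (conflict 68))) (split 55 (split 56 (conflict 68) (conflict 68))
  (split 56 (conflict 68) (conflict 68)))) (split 54 (split 55 (split 56 (conflict 60) (conflict
  60)) (split 56 (conflict 60) (conflict 60))) (split 55 (split 56 (conflict 58) (conflict 58))
  (split 56 (conflict 56) (conflict 57)))))) (conflict 76)) (split 64 (split 63 (split 59 (split
  60 (split 61 (split 62 (conflict 64) (conflict 64)) (split 62 (conflict 64) (conflict 64)))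
  (split 61 (split 62 (conflict 63) (conflict 63)) (split 62 (conflict 66) (conflict 66)))) (split
  60 (split 61 (split 62 (conflict 65) (conflict 65)) (split 62 (conflict 61) (conflict 62)))
  (split 61 (split 62 (conflict 65) (conflict 65)) (split 62 (conflict 66) (conflict 66)))))
  (conflict 75)) (conflict 77))) (split 71 (split 70 (split 66 (split 67 (split 68 (split 69
  (conflict 72) (conflict 72)) (split 69 (conflict 72) (conflict 72))) (split 68 (split 69
  (conflict 71) (conflict 71)) (split 69 (conflict 74) (conflict 74)))) (split 67 (split 68 (split
  69 (conflict 73) (conflict 73)) (split 69 (conflict 69) (conflict 70))) (split 68 (split 69
  (conflict 73) (conflict 73)) (split 69 (conflict 74) (conflict 74))))) (conflict 78)) (conflict
  81))) (conflict 230))) (split 121 (split 101 (split 100 (split 93 (split 86 (split 85 (split 80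
  (split 79 (split 75 (split 76 (split 77 (split 78 (conflict 85) (conflict 85)) (split 78
  (conflict 85) (conflict 85))) (split 77 (split 78 (conflict 84) (conflict 84)) (split 78
  (conflict 87) (conflict 87)))) (split 76 (split 77 (split 78 (conflict 86) (conflict 86)) (split
  78 (conflict 82) (conflict 83))) (split 77 (split 78 (conflict 86) (conflict 86)) (split 78
  (conflict 87) (conflict 87))))) (conflict 91)) (conflict 99)) (split 81 (split 82 (split 83
  (split 84 (conflict 100) (conflict 100)) (split 84 (conflict 100) (conflict 100))) (split 83
  (split 84 (conflict 100) (conflict 100)) (split 84 (conflict 100) (conflict 100)))) (split 82
  (split 83 (split 84 (conflict 92) (conflict 92)) (split 84 (conflict 92) (conflict 92))) (split
  83 (split 84 (conflict 90) (conflict 90)) (split 84 (conflict 88) (conflict 89)))))) (conflict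
  108)) (split 92 (split 91 (split 87 (split 88 (split 89 (split 90 (conflict 96) (conflict 96))
  (split 90 (conflict 96) (conflict 96))) (split 89 (split 90 (conflict 95) (conflict 95)) (split
  90 (conflict 98) (conflict 98)))) (split 88 (split 89 (split 90 (conflict 97) (conflict 97))
  (split 90 (conflict 93) (conflict 94))) (split 89 (split 90 (conflict 97) (conflict 97)) (split
  90 (conflict 98) (conflict 98))))) (conflict 107)) (conflict 109))) (split 99 (split 98 (split
  94 (split 95 (split 96 (split 97 (conflict 104) (conflict 104)) (split 97 (conflict 104)
  (conflict 104))) (split 96 (split 97 (conflict 103) (conflict 103)) (split 97 (conflict 106)
  (conflict 106)))) (split 95 (split 96 (split 97 (conflict 105) (conflict 105)) (split 97
  (conflict 101) (conflict 102))) (split 96 (split 97 (conflict 105) (conflict 105)) (split 97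
  (conflict 106) (conflict 106))))) (conflict 110)) (conflict 130))) (conflict 231)) (split 120
  (split 113 (split 112 (split 107 (split 106 (split 102 (split 103 (split 104 (split 105
  (conflict 114) (conflict 114)) (split 105 (conflict 114) (conflict 114))) (split 104 (split 105
  (conflict 113) (conflict 113)) (split 105 (conflict 116) (conflict 116)))) (split 103 (split 104
  (split 105 (conflict 115) (conflict 115)) (split 105 (conflict 111) (conflict 112))) (split 104
  (split 105 (conflict 115) (conflict 115)) (split 105 (conflict 116) (conflict 116))))) (conflict
  120)) (conflict 128)) (split 108 (split 109 (split 110 (split 111 (conflict 129) (conflict 129))
  (split 111 (conflict 129) (conflict 129))) (split 110 (split 111 (conflict 129) (conflict 129))
  (split 111 (conflict 129) (conflict 129)))) (split 109 (split 110 (split 111 (conflict 121)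
  (conflict 121)) (split 111 (conflict 121) (conflict 121))) (split 110 (split 111 (conflict 119)
  (conflict 119)) (split 111 (conflict 117) (conflict 118)))))) (conflict 133)) (split 119 (split
  118 (split 114 (split 115 (split 116 (split 117 (conflict 125) (conflict 125)) (split 117
  (conflict 125) (conflict 125))) (split 116 (split 117 (conflict 124) (conflict 124)) (split 117
  (conflict 127) (conflict 127)))) (split 115 (split 116 (split 117 (conflict 126) (conflict 126))
  (split 117 (conflict 122) (conflict 123))) (split 116 (split 117 (conflict 126) (conflict 126))
  (split 117 (conflict 127) (conflict 127))))) (conflict 131)) (conflict 134))))) (split 210
  (split 169 (split 149 (split 148 (split 141 (split 134 (split 133 (split 128 (split 127 (split
  123 (split 124 (split 125 (split 126 (conflict 138) (conflict 138)) (split 126 (conflict 138)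
  (conflict 138))) (split 125 (split 126 (conflict 137) (conflict 137)) (split 126 (conflict 140)
  (conflict 140)))) (split 124 (split 125 (split 126 (conflict 139) (conflict 139)) (split 126
  (conflict 135) (conflict 136))) (split 125 (split 126 (conflict 139) (conflict 139)) (split 126
  (conflict 140) (conflict 140))))) (conflict 144)) (conflict 152)) (split 129 (split 130 (split
  131 (split 132 (conflict 153) (conflict 153)) (split 132 (conflict 153) (conflict 153))) (split
  131 (split 132 (conflict 153) (conflict 153)) (split 132 (conflict 153) (conflict 153)))) (split
  130 (split 131 (split 132 (conflict 145) (conflict 145)) (split 132 (conflict 145) (conflict
  145))) (split 131 (split 132 (conflict 143) (conflict 143)) (split 132 (conflict 141) (conflict
  142)))))) (conflict 161)) (split 140 (split 139 (split 135 (split 136 (split 137 (split 138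
  (conflict 149) (conflict 149)) (split 138 (conflict 149) (conflict 149))) (split 137 (split 138
  (conflict 148) (conflict 148)) (split 138 (conflict 151) (conflict 151)))) (split 136 (split 137
  (split 138 (conflict 150) (conflict 150)) (split 138 (conflict 146) (conflict 147))) (split 137
  (split 138 (conflict 150) (conflict 150)) (split 138 (conflict 151) (conflict 151))))) (conflict
  160)) (conflict 162))) (split 147 (split 146 (split 142 (split 143 (split 144 (split 145
  (conflict 157) (conflict 157)) (split 145 (conflict 157) (conflict 157))) (split 144 (split 145
  (conflict 156) (conflict 156)) (split 145 (conflict 159) (conflict 159)))) (split 143 (split 144
  (split 145 (conflict 158) (conflict 158)) (split 145 (conflict 154) (conflict 155))) (split 144
  (split 145 (conflict 158) (conflict 158)) (split 145 (conflict 159) (conflict 159))))) (conflict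
  163)) (conflict 183))) (conflict 232)) (split 168 (split 161 (split 160 (split 155 (split 154
  (split 150 (split 151 (split 152 (split 153 (conflict 167) (conflict 167)) (split 153 (conflict
  167) (conflict 167))) (split 152 (split 153 (conflict 166) (conflict 166)) (split 153 (conflict
  169) (conflict 169)))) (split 151 (split 152 (split 153 (conflict 168) (conflict 168)) (split
  153 (conflict 164) (conflict 165))) (split 152 (split 153 (conflict 168) (conflict 168)) (split
  153 (conflict 169) (conflict 169))))) (conflict 173)) (conflict 181)) (split 156 (split 157
  (split 158 (split 159 (conflict 182) (conflict 182)) (split 159 (conflict 182) (conflict 182)))
  (split 158 (split 159 (conflict 182) (conflict 182)) (split 159 (conflict 182) (conflict 182))))
  (split 157 (split 158 (split 159 (conflict 174) (conflict 174)) (split 159 (conflict 174)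
  (conflict 174))) (split 158 (split 159 (conflict 172) (conflict 172)) (split 159 (conflict 170)
  (conflict 171)))))) (conflict 228)) (split 167 (split 166 (split 162 (split 163 (split 164
  (split 165 (conflict 178) (conflict 178)) (split 165 (conflict 178) (conflict 178))) (split 164
  (split 165 (conflict 177) (conflict 177)) (split 165 (conflict 180) (conflict 180)))) (split 163
  (split 164 (split 165 (conflict 179) (conflict 179)) (split 165 (conflict 175) (conflict 176)))
  (split 164 (split 165 (conflict 179) (conflict 179)) (split 165 (conflict 180) (conflict
  180))))) (conflict 184)) (conflict 229)))) (split 209 (split 196 (split 195 (split 188 (split
  181 (split 180 (split 175 (split 174 (split 170 (split 171 (split 172 (split 173 (conflict 188)
  (conflict 188)) (split 173 (conflict 188) (conflict 188))) (split 172 (split 173 (conflict 187)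
  (conflict 187)) (split 173 (conflict 190) (conflict 190)))) (split 171 (split 172 (split 173
  (conflict 189) (conflict 189)) (split 173 (conflict 185) (conflict 186))) (split 172 (split 173
  (conflict 189) (conflict 189)) (split 173 (conflict 190) (conflict 190))))) (conflict 194))
  (conflict 202)) (split 176 (split 177 (split 178 (split 179 (conflict 203) (conflict 203))
  (split 179 (conflict 203) (conflict 203))) (split 178 (split 179 (conflict 203) (conflict 203))
  (split 179 (conflict 203) (conflict 203)))) (split 177 (split 178 (split 179 (conflict 195)
  (conflict 195)) (split 179 (conflict 195) (conflict 195))) (split 178 (split 179 (conflict 193)
  (conflict 193)) (split 179 (conflict 191) (conflict 192)))))) (conflict 211)) (split 187 (split
  186 (split 182 (split 183 (split 184 (split 185 (conflict 199) (conflict 199)) (split 185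
  (conflict 199) (conflict 199))) (split 184 (split 185 (conflict 198) (conflict 198)) (split 185
  (conflict 201) (conflict 201)))) (split 183 (split 184 (split 185 (conflict 200) (conflict 200))
  (split 185 (conflict 196) (conflict 197))) (split 184 (split 185 (conflict 200) (conflict 200))
  (split 185 (conflict 201) (conflict 201))))) (conflict 210)) (conflict 212))) (split 194 (split
  193 (split 189 (split 190 (split 191 (split 192 (conflict 207) (conflict 207)) (split 192
  (conflict 207) (conflict 207))) (split 191 (split 192 (conflict 206) (conflict 206)) (split 192
  (conflict 209) (conflict 209)))) (split 190 (split 191 (split 192 (conflict 208) (conflict 208))
  (split 192 (conflict 204) (conflict 205))) (split 191 (split 192 (conflict 208) (conflict 208))
  (split 192 (conflict 209) (conflict 209))))) (conflict 213)) (conflict 225))) (conflict 233))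
  (split 208 (split 207 (split 202 (split 201 (split 197 (split 198 (split 199 (split 200
  (conflict 217) (conflict 217)) (split 200 (conflict 217) (conflict 217))) (split 199 (split 200
  (conflict 216) (conflict 216)) (split 200 (conflict 219) (conflict 219)))) (split 198 (split 199
  (split 200 (conflict 218) (conflict 218)) (split 200 (conflict 214) (conflict 215))) (split 199
  (split 200 (conflict 218) (conflict 218)) (split 200 (conflict 219) (conflict 219))))) (conflict
  223)) (conflict 226)) (split 203 (split 204 (split 205 (split 206 (conflict 227) (conflict 227))
  (split 206 (conflict 227) (conflict 227))) (split 205 (split 206 (conflict 227) (conflict 227))
  (split 206 (conflict 227) (conflict 227)))) (split 204 (split 205 (split 206 (conflict 224)
  (conflict 224)) (split 206 (conflict 224) (conflict 224))) (split 205 (split 206 (conflict 222)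
  (conflict 222)) (split 206 (conflict 220) (conflict 221)))))) (conflict 234))))

mainTheorem4 : ∃ λ (F : Formula) → IsKSFormula 4 5 F × Unsatisfiable F × length F ≡ 235
mainTheorem4 = formula , (cnf , fourLiterals , atMostFive) , unsatisfiable , refl
  where
  cnf : IsCNF formula
  cnf = from-yes (isCNF? formula)
  fourLiterals : All (λ C → length C ≡ 4) formula
  fourLiterals = from-yes (all? (λ C → length C ℕ.≟ 4) formula)
  atMostFive : ∀ x → occurrences x formula ≤ 5
  atMostFive = occurrences-≤ (from-yes (varsBelow? 212 formula))
                             (from-yes (all? (λ x → occurrences x formula ≤? 5) (upTo 212)))
  unsatisfiable : Unsatisfiable formula
  unsatisfiable = refuted⇒unsatisfiable refutation (from-yes (refutes? formula [] refutation))
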